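{- Assume the setting described in the context, with $\ell$, $u_i$, $v_i$ as defined there. For each $i=1,2,\ldots$, the sequence $\pi(1),\ldots,\pi(u_i)$ is the unique subsequence of $\pi$ of its order isomorphism type. Moreover, the permutation $\beta=\beta(1)\cdots\beta(u_i)$ order isomorphic to $\pi(1),\ldots,\pi(u_i)$ is the longest permutation in $X$ satisfying: (1) $\beta(1),\ldots,\beta(u_{i-1})$ is order isomorphic to $\pi(1),\ldots,\pi(u_{i-1})$ (where $u_0=\ell$); and (2) $\beta(u_i)\le\beta(v_i)$.
   Context: A permutation of length $n$ is an arrangement of $1,\ldots,n$; order isomorphism means same relative order; $\alpha\preceq\beta$ means $\alpha$ is order isomorphic to a subsequence of $\beta$, and a sequence involves $\gamma$ if $\gamma\preceq$ it. A closed set is a set of finite permutations closed downward under $\preceq$; its basis is the set of $\preceq$-minimal permutations not in it. $\mathrm{Sub}(\pi)$ is the set of finite permutations order isomorphic to finite subsequences of $\pi$. For permutations $\alpha$ (length $m$) and $\beta$, $\alpha\oplus\beta$ is $\alpha$ followed by $\beta$ with entries increased by $m$; a finite permutation is indecomposable if it is not $\alpha\oplus\beta$ with both nonempty, and each finite permutation is uniquely $\beta_1\oplus\cdots\oplus\beta_s$ with indecomposable $\beta_j$, $\beta_s$ its final sum component. Sum components of $\pi:\mathbb{N}\to\mathbb{N}$: $n\ge1$ is a cut point if $\{\pi(1),\ldots,\pi(n)\}=\{1,\ldots,n\}$; sum components are the segments between consecutive cut points, plus the infinite segment after the last cut point if there are finitely many (the final component). Setting: $\pi:\mathbb{N}\to\mathbb{N}$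 is a bijection such that $X=\mathrm{Sub}(\pi)$ has a finite basis $B$; $C$ is the set of final sum components of elements of $B$; $\pi$ has finitely many sum components and its final (infinite) component involves an element of $C$. $\ell$ is the largest position of $\pi$ that is a term of some subsequence of $\pi$ order isomorphic to an element of $C$ (such a largest position exists, and it lies in the final sum component). Define $u_0=\ell$ and for $i\ge1$: $v_i$ is the position $p\le u_{i-1}$ with $\pi(p)=\max\{\pi(q):q\le u_{i-1}\}$, and $u_i=\max\{q:\pi(q)\le\pi(v_i)\}$. -}

module Defs where

open import Data.Nat using (ℕ; zero; suc; _<_; _≤_)
open import Data.Fin using (Fin; toℕ; cast)
open import Data.Product using (Σ; ∃; _×_; _,_)
open import Data.List using (List)
open import Data.List.Relation.Unary.Any using (Any)
open import Relation.Nullary using (¬_)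
open import Relation.Binary.PropositionalEquality using (_≡_)

-- Conventions: positions and values are 0-based.  Paper position p is our p - 1,
-- paper value x is our x - 1.  A prefix "π(1),…,π(u)" of the paper (length u)
-- is our positions 0 … u-1.

OrdIso : {A : Set} → (A → ℕ) → (A → ℕ) → Set
OrdIso a b = ∀ i j → (a i < a j → b i < b j) × (b i < b j → a i < a j)

IncrFin : {m n : ℕ} → (Fin m → Fin n) → Set
IncrFin e = ∀ i j → toℕ i < toℕ j → toℕ (e i) < toℕ (e j)

Incr : {m : ℕ} → (Fin m → ℕ) → Set
Incr q = ∀ i j → toℕ i < toℕ j → q i < q j

record FPerm : Set where
  constructor perm
  field
    len     : ℕ
    seq     : Fin len → ℕ
    bounded : ∀ i → seq i < len
    inj     : ∀ i j → seq i ≡ seq j → i ≡ j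
open FPerm public

PermEq : FPerm → FPerm → Set
PermEq α β = Σ (len α ≡ len β) λ e → ∀ i → seq α i ≡ seq β (cast e i)

_⪯_ : FPerm → FPerm → Set
α ⪯ β = Σ (Fin (len α) → Fin (len β)) λ e → IncrFin e × OrdIso (seq α) (λ i → seq β (e i))

_≺_ : FPerm → FPerm → Set
α ≺ β = (α ⪯ β) × ¬ (β ⪯ α)

Occurs : (ℕ → ℕ) → (γ : FPerm) → (Fin (len γ) → ℕ) → Set
Occurs π γ q = Incr q × OrdIso (λ j → π (q j)) (seq γ)

InSub : (ℕ → ℕ) → FPerm → Set
InSub π γ = Σ (Fin (len γ) → ℕ) λ q → Occurs π γ q

IsBasisElt : (ℕ → ℕ) → FPerm → Set
IsBasisElt π α = ¬ InSub π α × (∀ γ → γ ≺ α → InSub π γ)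

-- the list B enumerates exactly the basis of Sub(π) (so the basis is finite)
IsBasisList : (ℕ → ℕ) → List FPerm → Set
IsBasisList π B = ∀ α → (IsBasisElt π α → Any (PermEq α) B) × (Any (PermEq α) B → IsBasisElt π α)

Cut : FPerm → ℕ → Set
Cut α k = ∀ i → toℕ i < k → seq α i < k

-- γ is the final sum component of α: α restricted to the positions after the
-- last cut point k < len α
IsFinalComp : FPerm → FPerm → Set
IsFinalComp γ α =
  Σ ℕ λ k → k < len α × Cut α k
    × (∀ k′ → k < k′ → k′ < len α → ¬ Cut α k′)
    × Σ (Fin (len γ) → Fin (len α)) λ e → IncrFin e
        × (∀ j → k ≤ toℕ (e j))
        × (∀ i → k ≤ toℕ i → ∃ λ j → e j ≡ i)
        × OrdIso (seq γ) (λ j → seq α (e j))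

InC : List FPerm → FPerm → Set
InC B γ = Any (IsFinalComp γ) B

CutInf : (ℕ → ℕ) → ℕ → Set
CutInf π n = ∀ p → p < n → π p < n

-- π has a last cut point m (finitely many sum components) and its final
-- component (positions ≥ m) involves an element of C
FinalCompInvolvesC : (ℕ → ℕ) → List FPerm → Set
FinalCompInvolvesC π B =
  Σ ℕ λ m → CutInf π m × (∀ n → CutInf π n → n ≤ m)
    × Σ FPerm λ γ → InC B γ × Σ (Fin (len γ) → ℕ) λ q → Occurs π γ q × (∀ j → m ≤ q j)

IsEll : (ℕ → ℕ) → List FPerm → ℕ → Set
IsEll π B ℓ =
  (Σ FPerm λ γ → InC B γ × Σ (Fin (len γ) → ℕ) λ q → Occurs π γ q × ∃ λ j → q j ≡ ℓ)
  × (∀ γ → InC B γ → ∀ q → Occurs π γ q → ∀ j → q j ≤ ℓ)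

-- u 0 = ℓ, and for i ≥ 1 (written suc i): v (suc i) is the position of the
-- maximum of π on positions ≤ u i, and u (suc i) is the largest position q
-- with π q ≤ π (v (suc i)).  (v 0 is unused.)
IsUV : (ℕ → ℕ) → ℕ → (ℕ → ℕ) → (ℕ → ℕ) → Set
IsUV π ℓ u v =
  u 0 ≡ ℓ
  × (∀ i → v (suc i) ≤ u i × (∀ q → q ≤ u i → π q ≤ π (v (suc i))))
  × (∀ i → π (u (suc i)) ≤ π (v (suc i)) × (∀ q → u (suc i) < q → π (v (suc i)) < π q))

UniquePrefix : (ℕ → ℕ) → ℕ → Set
UniquePrefix π U =
  ∀ (q : Fin (suc U) → ℕ) → Incr q → OrdIso (λ j → π (q j)) (λ j → π (toℕ j))
    → ∀ j → q j ≡ toℕ j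

IsStdPrefix : (ℕ → ℕ) → ℕ → FPerm → Set
IsStdPrefix π U β = Σ (len β ≡ suc U) λ e → OrdIso (seq β) (λ j → π (toℕ (cast e j)))

-- conditions (1) and (2), with w = u_{i-1} and v = v_i (0-based positions):
-- (1) γ's first w+1 entries are order isomorphic to π(0),…,π(w);
-- (2) the last entry of γ is ≤ the entry of γ at position v.
Conds : (ℕ → ℕ) → ℕ → ℕ → FPerm → Set
Conds π w v γ =
  suc w ≤ len γ
  × (∀ a b → toℕ {len γ} a ≤ w → toℕ {len γ} b ≤ w
       → (seq γ a < seq γ b → π (toℕ a) < π (toℕ b))
       × (π (toℕ a) < π (toℕ b) → seq γ a < seq γ b))
  × (∀ a b → toℕ {len γ} a ≡ v → suc (toℕ {len γ} b) ≡ len γ → seq γ b ≤ seq γ a)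

LongestWith : (ℕ → ℕ) → ℕ → ℕ → FPerm → Set
LongestWith π w v β =
  InSub π β × Conds π w v β
  × (∀ γ → InSub π γ → Conds π w v γ → len γ ≤ len β)

module Submission where

open import Defs
open import Data.Nat using (ℕ; zero; suc; _<_; _≤_; z≤n; s≤s; s≤s⁻¹; _<?_)
open import Data.Nat.Properties
open import Data.Fin using (Fin; toℕ; fromℕ<; fromℕ)
open import Data.Fin.Properties using (toℕ-fromℕ<; fromℕ<-toℕ; fromℕ<-cong; toℕ<n; toℕ-cast; toℕ-fromℕ)
open import Data.Product using (_×_; _,_; proj₁; proj₂)
open import Data.Sum using (inj₁; inj₂)
open import Data.List using (List)
open import Data.Empty using (⊥-elim)
open import Relation.Nullary using (yes; no)
open import Function.Definitions using (Bijective)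
open import Relation.Binary.PropositionalEquality using (_≡_; refl; sym; trans; cong; subst; subst₂)

-- An increasing map of positions that keeps π(0),…,π(W) in the same relative
-- order cannot move ℓ to the right: the image of an occurrence of an element of C
-- is again one.  It then cannot move any u_i to the right either, because it
-- fixes v_i ≤ u_{i-1}, and every position to the right of u_i carries a value
-- above π(v_i).  Finally an increasing map with f(k) ≤ k fixes 0,…,k, which gives
-- both uniqueness of the prefix and the bound on the length.

IncreasingUpTo : (ℕ → ℕ) → ℕ → Set
IncreasingUpTo f W = ∀ {a b} → a < b → b ≤ W → f a < f b

module _ {f : ℕ → ℕ} {W : ℕ} (increasing : IncreasingUpTo f W) where

  increasing⇒≥ : ∀ {a} → a ≤ W → a ≤ f a
  increasing⇒≥ {zero}  _   = z≤n
  increasing⇒≥ {suc a} a<W = ≤-<-trans (increasing⇒≥ (<⇒≤ a<W)) (increasing (n<1+n a) a<W)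

  increasing⇒≤-below : ∀ {k j} → k ≤ W → f k ≤ k → j ≤ k → f j ≤ j
  increasing⇒≤-below {zero}  _   fk≤k z≤n = fk≤k
  increasing⇒≤-below {suc k} k<W fk≤k j≤k with m≤n⇒m<n∨m≡n j≤k
  ... | inj₂ refl        = fk≤k
  ... | inj₁ (s≤s j≤k′) =
    increasing⇒≤-below (<⇒≤ k<W) (s≤s⁻¹ (<-≤-trans (increasing (n<1+n k) k<W) fk≤k)) j≤k′

  increasing⇒fixed-below : ∀ {k j} → k ≤ W → f k ≤ k → j ≤ k → f j ≡ j
  increasing⇒fixed-below k≤W fk≤k j≤k =
    ≤-antisym (increasing⇒≤-below k≤W fk≤k j≤k) (increasing⇒≥ (≤-trans j≤k k≤W))

-- Extension of a finite choice of positions to all of ℕ; the value 0 beyond m is junk.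
extend : ∀ {m} → (Fin m → ℕ) → ℕ → ℕ
extend {m} q n with n <? m
... | yes n<m = q (fromℕ< n<m)
... | no  _   = 0

extend-fromℕ< : ∀ {m} (q : Fin m → ℕ) {n} (n<m : n < m) → extend q n ≡ q (fromℕ< n<m)
extend-fromℕ< {m} q {n} n<m with n <? m
... | yes n<m′ = cong q (fromℕ<-cong n n refl n<m′ n<m)
... | no  n≮m  = ⊥-elim (n≮m n<m)

extend-toℕ : ∀ {m} (q : Fin m → ℕ) (j : Fin m) → extend q (toℕ j) ≡ q j
extend-toℕ q j = trans (extend-fromℕ< q (toℕ<n j)) (cong q (fromℕ<-toℕ j _))

extend-increasing : ∀ {m} {q : Fin m → ℕ} → Incr q → ∀ {W} → W < m → IncreasingUpTo (extend q) W
extend-increasing {q = q} incr W<m {a} {b} a<b b≤W =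
  subst₂ _<_ (sym (extend-fromℕ< q a<m)) (sym (extend-fromℕ< q b<m))
    (incr _ _ (subst₂ _<_ (sym (toℕ-fromℕ< a<m)) (sym (toℕ-fromℕ< b<m)) a<b))
  where
    b<m = ≤-<-trans b≤W W<m
    a<m = <-trans a<b b<m

increasing⇒≥toℕ : ∀ {m} {q : Fin m → ℕ} → Incr q → ∀ j → toℕ j ≤ q j
increasing⇒≥toℕ {q = q} incr j =
  subst (toℕ j ≤_) (extend-toℕ q j) (increasing⇒≥ (extend-increasing incr (toℕ<n j)) ≤-refl)

module Prefixes (π : ℕ → ℕ) where

  OrderIsoUpTo : (ℕ → ℕ) → ℕ → Set
  OrderIsoUpTo f W = ∀ {a b} → a ≤ W → b ≤ W
    → (π (f a) < π (f b) → π a < π b) × (π a < π b → π (f a) < π (f b))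

  record IsPrefixEmbedding (W : ℕ) (f : ℕ → ℕ) : Set where
    field
      increasing : IncreasingUpTo f W
      orderIso   : OrderIsoUpTo f W

  OrderedLikePrefix : ∀ {m} → (Fin m → ℕ) → ℕ → Set
  OrderedLikePrefix q W = ∀ a b → toℕ a ≤ W → toℕ b ≤ W
    → (π (q a) < π (q b) → π (toℕ a) < π (toℕ b)) × (π (toℕ a) < π (toℕ b) → π (q a) < π (q b))

  extend-isPrefixEmbedding : ∀ {m} {q : Fin m → ℕ} → Incr q → ∀ {W} → W < m
    → OrderedLikePrefix q W → IsPrefixEmbedding W (extend q)
  extend-isPrefixEmbedding {q = q} incr {W} W<m ordered = record
    { increasing = extend-increasing incr W<m
    ; orderIso   = orderIso
    }
    where
      orderIso : OrderIsoUpTo (extend q) W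
      orderIso a≤W b≤W = orderIso′ (≤-<-trans a≤W W<m) (≤-<-trans b≤W W<m) a≤W b≤W
        where
          orderIso′ : ∀ {a b} (a<m : a < _) (b<m : b < _) → a ≤ W → b ≤ W
            → (π (extend q a) < π (extend q b) → π a < π b) × (π a < π b → π (extend q a) < π (extend q b))
          orderIso′ a<m b<m a≤W b≤W
            rewrite extend-fromℕ< q a<m | extend-fromℕ< q b<m =
            subst₂ (λ x y → (π (q (fromℕ< a<m)) < π (q (fromℕ< b<m)) → π x < π y)
                          × (π x < π y → π (q (fromℕ< a<m)) < π (q (fromℕ< b<m))))
              (toℕ-fromℕ< a<m) (toℕ-fromℕ< b<m)
              (ordered _ _ (subst (_≤ W) (sym (toℕ-fromℕ< a<m)) a≤W)
                           (subst (_≤ W) (sym (toℕ-fromℕ< b<m)) b≤W))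

  embedding-maps-occurrence : ∀ {W f} → IsPrefixEmbedding W f
    → ∀ {γ q} → Occurs π γ q → (∀ j → q j ≤ W) → Occurs π γ (λ j → f (q j))
  embedding-maps-occurrence emb (incr , iso) q≤W =
      (λ a b a<b → increasing (incr a b a<b) (q≤W b))
    , λ a b → (λ lt → proj₁ (iso a b) (proj₁ (orderIso (q≤W a) (q≤W b)) lt))
            , (λ lt → proj₂ (orderIso (q≤W a) (q≤W b)) (proj₂ (iso a b) lt))
    where open IsPrefixEmbedding emb

  stdPrefix-orderIso : ∀ U β → IsStdPrefix π U β → ∀ a b
    → (seq β a < seq β b → π (toℕ a) < π (toℕ b)) × (π (toℕ a) < π (toℕ b) → seq β a < seq β b)
  stdPrefix-orderIso U β (len≡ , iso) a b =
    subst₂ (λ x y → (seq β a < seq β b → π x < π y) × (π x < π y → seq β a < seq β b))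
      (toℕ-cast len≡ a) (toℕ-cast len≡ b) (iso a b)

  stdPrefix-inSub : ∀ U β → IsStdPrefix π U β → InSub π β
  stdPrefix-inSub U β std =
    toℕ , (λ _ _ a<b → a<b)
        , λ a b → proj₂ (stdPrefix-orderIso U β std a b) , proj₁ (stdPrefix-orderIso U β std a b)

module Ladder (π : ℕ → ℕ) (B : List FPerm) (ℓ : ℕ) (isEll : IsEll π B ℓ)
              (u v : ℕ → ℕ) (isUV : IsUV π ℓ u v) where
  open Prefixes π

  private
    u₀≡ℓ = proj₁ isUV
    v-spec = proj₁ (proj₂ isUV)
    u-spec = proj₂ (proj₂ isUV)

  v≤u : ∀ i → v (suc i) ≤ u i
  v≤u i = proj₁ (v-spec i)

  u-monotone : ∀ i → u i ≤ u (suc i)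
  u-monotone i = ≮⇒≥ λ u′<u → <⇒≱ (proj₂ (u-spec i) (u i) u′<u) (proj₂ (v-spec i) (u i) ≤-refl)

  embedding-ℓ≤ : ∀ {W f} → IsPrefixEmbedding W f → ℓ ≤ W → f ℓ ≤ ℓ
  embedding-ℓ≤ {W} {f} emb ℓ≤W with proj₁ isEll
  ... | γ , γ∈C , q , occ , j , qj≡ℓ =
    subst (λ x → f x ≤ ℓ) qj≡ℓ (ℓ-max γ γ∈C _ (embedding-maps-occurrence emb {γ} occ q≤W) j)
    where
      ℓ-max = proj₂ isEll
      q≤W : ∀ j → q j ≤ W
      q≤W j = ≤-trans (ℓ-max γ γ∈C q occ j) ℓ≤W

  embedding-u≤ : ∀ {W f} → IsPrefixEmbedding W f → ∀ i → u i ≤ W → f (u i) ≤ u i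
  embedding-u≤ emb zero u≤W rewrite u₀≡ℓ = embedding-ℓ≤ emb u≤W
  embedding-u≤ {W} {f} emb (suc i) u≤W = ≮⇒≥ λ u<fu →
    <⇒≱ (proj₁ (orderIso (≤-trans (v≤u i) uᵢ≤W) u≤W) (πfv<πfu u<fu)) (proj₁ (u-spec i))
    where
      open IsPrefixEmbedding emb
      uᵢ≤W = ≤-trans (u-monotone i) u≤W
      fv≡v : f (v (suc i)) ≡ v (suc i)
      fv≡v = increasing⇒fixed-below increasing uᵢ≤W (embedding-u≤ emb i uᵢ≤W) (v≤u i)
      πfv<πfu : u (suc i) < f (u (suc i)) → π (f (v (suc i))) < π (f (u (suc i)))
      πfv<πfu u<fu rewrite fv≡v = proj₂ (u-spec i) _ u<fu

  occurrence-fixes-prefix : ∀ {m} {q : Fin m → ℕ} → Incr q → ∀ {W} → W < m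
    → OrderedLikePrefix q W → ∀ i → u i ≤ W → ∀ j → toℕ j ≤ u i → q j ≡ toℕ j
  occurrence-fixes-prefix {q = q} incr W<m ordered i u≤W j j≤u =
    trans (sym (extend-toℕ q j))
      (increasing⇒fixed-below (IsPrefixEmbedding.increasing emb) u≤W (embedding-u≤ emb i u≤W) j≤u)
    where emb = extend-isPrefixEmbedding incr W<m ordered

  -- The last entry of γ sits at a position ≥ len γ - 1 whose value is at most
  -- π(v_i), since the positions 0,…,u_{i-1} (hence v_i) are fixed; so len γ - 1 ≤ u_i.
  conds⇒len≤ : ∀ i γ → InSub π γ → Conds π (u i) (v (suc i)) γ → len γ ≤ suc (u (suc i))
  conds⇒len≤ i (perm zero _ _ _) _ _ = z≤n
  conds⇒len≤ i (perm (suc n) _ _ _) (q , incr , iso) (u<len , prefixIso , last≤v) =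
    s≤s (≤-trans n≤q-last q-last≤u)
    where
      ordered : OrderedLikePrefix q (u i)
      ordered a b a≤u b≤u = (λ lt → proj₁ (prefixIso a b a≤u b≤u) (proj₁ (iso a b) lt))
                          , (λ lt → proj₂ (iso a b) (proj₂ (prefixIso a b a≤u b≤u) lt))
      v<len = ≤-<-trans (v≤u i) u<len
      vᶠ = fromℕ< v<len
      last = fromℕ n
      q-v≡v : q vᶠ ≡ v (suc i)
      q-v≡v = trans (occurrence-fixes-prefix incr u<len ordered i ≤-refl vᶠ
                       (subst (_≤ u i) (sym (toℕ-fromℕ< v<len)) (v≤u i)))
                    (toℕ-fromℕ< v<len)
      πq-last≤πv : π (q last) ≤ π (v (suc i))
      πq-last≤πv = subst (λ x → π (q last) ≤ π x) q-v≡v (≮⇒≥ λ lt →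
        <⇒≱ (proj₁ (iso vᶠ last) lt) (last≤v vᶠ last (toℕ-fromℕ< v<len) (cong suc (toℕ-fromℕ n))))
      q-last≤u : q last ≤ u (suc i)
      q-last≤u = ≮⇒≥ λ u<q → <⇒≱ (proj₂ (u-spec i) (q last) u<q) πq-last≤πv
      n≤q-last : n ≤ q last
      n≤q-last = subst (_≤ q last) (toℕ-fromℕ n) (increasing⇒≥toℕ incr last)

  stdPrefix-conds : ∀ i β → IsStdPrefix π (u (suc i)) β → Conds π (u i) (v (suc i)) β
  stdPrefix-conds i β std@(len≡ , _) =
      subst (suc (u i) ≤_) (sym len≡) (s≤s (u-monotone i))
    , (λ a b _ _ → stdPrefix-orderIso (u (suc i)) β std a b)
    , λ a b a≡v b≡last → ≮⇒≥ λ lt →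
        <⇒≱ (subst₂ (λ x y → π x < π y) a≡v (suc-injective (trans b≡last len≡))
               (proj₁ (stdPrefix-orderIso (u (suc i)) β std a b) lt))
            (proj₁ (u-spec i))

lemma5 : (π : ℕ → ℕ) → Bijective _≡_ _≡_ π
    → (B : List FPerm) → IsBasisList π B
    → FinalCompInvolvesC π B
    → (ℓ : ℕ) → IsEll π B ℓ
    → (u v : ℕ → ℕ) → IsUV π ℓ u v
    → (i : ℕ)
    → UniquePrefix π (u (suc i))
    × (∀ β → IsStdPrefix π (u (suc i)) β → LongestWith π (u i) (v (suc i)) β)
-- Bijectivity, the basis and the final component only serve to make ℓ, u and v
-- exist; once they are given, the argument does not need them.
lemma5 π _ B _ _ ℓ isEll u v isUV i = uniquePrefix , longest
  where
    open Prefixes π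
    open Ladder π B ℓ isEll u v isUV
    U = u (suc i)

    uniquePrefix : UniquePrefix π U
    uniquePrefix q incr iso j =
      occurrence-fixes-prefix incr (n<1+n U) (λ a b _ _ → iso a b) (suc i) ≤-refl j (s≤s⁻¹ (toℕ<n j))

    longest : ∀ β → IsStdPrefix π U β → LongestWith π (u i) (v (suc i)) β
    longest β std@(len≡ , _) =
        stdPrefix-inSub U β std
      , stdPrefix-conds i β std
      , λ γ γ∈X conds → subst (len γ ≤_) (sym len≡) (conds⇒len≤ i γ γ∈X conds)
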